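{- Let $\langle A,\rightarrow,\top\rangle$ be a BCI-algebra with induced relation $\preceq$. Then $\langle A,\rightarrow,\top\rangle$ is a BCK-algebra if and only if for each $x\in A$ there exists $y\in A$ such that $y\preceq x$ and $y\preceq \top$.
   Context: A BCI-algebra is a structure $\langle A,\rightarrow,\top\rangle$, with $\rightarrow$ a binary operation on $A$ and $\top\in A$, such that for all $x,y,z\in A$: (C1) $(y\rightarrow z)\rightarrow((z\rightarrow x)\rightarrow(y\rightarrow x))=\top$; (C2) $x\rightarrow((x\rightarrow y)\rightarrow y)=\top$; (C3) $x\rightarrow x=\top$; (C4) if $x\rightarrow y=\top$ and $y\rightarrow x=\top$ then $x=y$. The induced relation is $x\preceq y$ iff $x\rightarrow y=\top$ (a partial order on $A$). A BCI-algebra is a BCK-algebra if $x\preceq\top$ (i.e. $x\rightarrow\top=\top$) for all $x\in A$. -}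

module Defs where

open import Level using (Level; suc)
open import Relation.Binary.PropositionalEquality using (_≡_)

record IsBCIAlgebra {a : Level} (A : Set a) (_⇒_ : A → A → A) (⊤ : A) : Set a where
  field
    C1 : ∀ x y z → ((y ⇒ z) ⇒ ((z ⇒ x) ⇒ (y ⇒ x))) ≡ ⊤
    C2 : ∀ x y → (x ⇒ ((x ⇒ y) ⇒ y)) ≡ ⊤
    C3 : ∀ x → (x ⇒ x) ≡ ⊤
    C4 : ∀ x y → (x ⇒ y) ≡ ⊤ → (y ⇒ x) ≡ ⊤ → x ≡ y

_≼[_,_]_ : {a : Level} {A : Set a} → A → (A → A → A) → A → A → Set a
x ≼[ _⇒_ , ⊤ ] y = (x ⇒ y) ≡ ⊤

IsBCKAlgebra : {a : Level} (A : Set a) (_⇒_ : A → A → A) (⊤ : A) → Set a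
IsBCKAlgebra A _⇒_ ⊤ = IsBCIAlgebra A _⇒_ ⊤ × (∀ x → x ≼[ _⇒_ , ⊤ ] ⊤)
  where open import Data.Product using (_×_)

module Submission where

-- In any BCI-algebra the constant ⊤ is a left unit:
-- ⊤ → b = b.  (Axiom C2 with C3 gives b ≼ ⊤ → b, and C2 at ⊤ gives
-- ⊤ ≼ (⊤ → b) → b; antisymmetry then shows (⊤ → b) → b = ⊤ and finally
-- ⊤ → b = b.)  With the left unit, axiom C1 says that x → z is antitone
-- in x: if y ≼ x then (x → z) ≼ (y → z).
--
-- The forward direction of the theorem is immediate (take y = x).  For the
-- converse, let y ≼ x with y ≼ ⊤.  Antitonicity with z = ⊤ gives
-- (x → ⊤) ≼ (y → ⊤) = ⊤, i.e. (x → ⊤) → ⊤ = ⊤; hence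
-- x → ⊤ = x → ((x → ⊤) → ⊤), which is ⊤ by C2.  So x ≼ ⊤ for every x.

open import Defs
open import Level using (Level)
open import Data.Product using (∃; _×_; _,_)
open import Function.Bundles using (_⇔_; mk⇔)
open import Relation.Binary.PropositionalEquality
  using (_≡_; sym; trans; cong; subst; module ≡-Reasoning)

module BCIProperties {a : Level} {A : Set a} {_⇒_ : A → A → A} {⊤ : A}
                     (bci : IsBCIAlgebra A _⇒_ ⊤) where

  open IsBCIAlgebra bci

  infix 4 _≼_
  _≼_ : A → A → Set a
  x ≼ y = x ≼[ _⇒_ , ⊤ ] y

  ≼-⊤⇒ : ∀ b → b ≼ (⊤ ⇒ b)
  ≼-⊤⇒ b = subst (λ t → b ⇒ (t ⇒ b) ≡ ⊤) (C3 b) (C2 b b)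

  ⊤⇒-identity : ∀ b → ⊤ ⇒ b ≡ b
  ⊤⇒-identity b = C4 (⊤ ⇒ b) b back≡⊤ (≼-⊤⇒ b)
    where
    back : A
    back = (⊤ ⇒ b) ⇒ b
    -- ⊤ ≼ back by C2, and back ≼ ⊤ → back = ⊤; so back = ⊤.
    ⊤≼back : ⊤ ≼ back
    ⊤≼back = C2 ⊤ b
    back≡⊤ : back ≡ ⊤
    back≡⊤ = C4 back ⊤ (subst (back ≼_) ⊤≼back (≼-⊤⇒ back)) ⊤≼back

  -- Implication is antitone in its first argument (C1 read with the left unit).
  ⇒-antitoneˡ : ∀ {x y} z → y ≼ x → (x ⇒ z) ≼ (y ⇒ z)
  ⇒-antitoneˡ {x} {y} z y≼x = begin
    (x ⇒ z) ⇒ (y ⇒ z)              ≡⟨ sym (⊤⇒-identity _) ⟩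
    ⊤ ⇒ ((x ⇒ z) ⇒ (y ⇒ z))        ≡⟨ cong (λ t → t ⇒ ((x ⇒ z) ⇒ (y ⇒ z))) (sym y≼x) ⟩
    (y ⇒ x) ⇒ ((x ⇒ z) ⇒ (y ⇒ z))  ≡⟨ C1 z y x ⟩
    ⊤                               ∎
    where open ≡-Reasoning

  ≼⊤-from-lower-bound : ∀ {x y} → y ≼ x → y ≼ ⊤ → x ≼ ⊤
  ≼⊤-from-lower-bound {x} {y} y≼x y≼⊤ = begin
    x ⇒ ⊤                  ≡⟨ cong (x ⇒_) (sym x⇒⊤≼⊤) ⟩
    x ⇒ ((x ⇒ ⊤) ⇒ ⊤)      ≡⟨ C2 x ⊤ ⟩
    ⊤                      ∎
    where
    open ≡-Reasoning
    x⇒⊤≼⊤ : (x ⇒ ⊤) ≼ ⊤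
    x⇒⊤≼⊤ = subst ((x ⇒ ⊤) ≼_) y≼⊤ (⇒-antitoneˡ ⊤ y≼x)

proposition3 : {a : Level} (A : Set a) (_⇒_ : A → A → A) (⊤ : A) →
    IsBCIAlgebra A _⇒_ ⊤ →
    (IsBCKAlgebra A _⇒_ ⊤ ⇔ (∀ x → ∃ λ y → y ≼[ _⇒_ , ⊤ ] x × y ≼[ _⇒_ , ⊤ ] ⊤))
proposition3 A _⇒_ ⊤ bci = mk⇔ bck⇒lower-bounds lower-bounds⇒bck
  where
  open IsBCIAlgebra bci using (C3)
  open BCIProperties bci using (_≼_; ≼⊤-from-lower-bound)

  bck⇒lower-bounds : IsBCKAlgebra A _⇒_ ⊤ → ∀ x → ∃ λ y → y ≼ x × y ≼ ⊤
  bck⇒lower-bounds (_ , x≼⊤) x = x , C3 x , x≼⊤ x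

  lower-bounds⇒bck : (∀ x → ∃ λ y → y ≼ x × y ≼ ⊤) → IsBCKAlgebra A _⇒_ ⊤
  lower-bounds⇒bck lower = bci , λ x → below-⊤ (lower x)
    where
    below-⊤ : ∀ {x} → (∃ λ y → y ≼ x × y ≼ ⊤) → x ≼ ⊤
    below-⊤ (_ , y≼x , y≼⊤) = ≼⊤-from-lower-bound y≼x y≼⊤
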